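{- Let $1\le s\le d/2$ and $n\ge d+1$. Let $\mathcal F\subseteq\binom{[n]}{d+1}$ be an $s$-witness family, and for each $F\in\mathcal F$ fix a witness $B_F\subseteq F$ with $|B_F|=s$ such that $F\cap F'\ne B_F$ for all $F'\in\mathcal F$. Let $\mathcal B=\{B\in\binom{[n]}{s}:\ \exists F\in\mathcal F \text{ with } B_F=B\}$. Then there is a constant $C$ depending only on $d$ such that for every $B\in\mathcal B$ there exists a family $\mathcal A_B$ of subsets of $[n]\setminus B$, each of size at most $d+1-s$, satisfying: (1) $\mathcal A_B$ is intersecting, i.e. $A\cap A'\neq\varnothing$ for all $A,A'\in\mathcal A_B$; (2) for every $F\in\mathcal F$ with $B_F=B$ there exists $A\in\mathcal A_B$ with $A\subseteq F$; (3) for every $F\in\mathcal F$ with $B\subseteq F$ (possibly $B_F\ne B$), we have $A\cap F\neq\varnothing$ for all $A\in\mathcal A_B$; (4) $|\mathcal A_B|\le C$.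
   Context: $[n]=\{1,\dots,n\}$, $\binom{X}{k}$ is the family of $k$-subsets of $X$. A family $\mathcal F\subseteq\binom{[n]}{d+1}$ is an $s$-witness family if for every $F\in\mathcal F$ there exists $B_F\subseteq F$ with $|B_F|=s$ such that $F\cap F'\neq B_F$ for every $F'\in\mathcal F$. -}

module Defs where

open import Data.Nat using (ℕ; _≤_; _+_; _*_; _∸_)
open import Data.Fin.Subset using (Subset; _⊆_; _∩_; ∣_∣; Nonempty; Empty)
open import Data.List using (List)
open import Data.List.Membership.Propositional using (_∈_)
open import Data.Product using (_×_; ∃-syntax)
open import Relation.Binary.PropositionalEquality using (_≡_; _≢_)

UniformFamily : (n d : ℕ) → List (Subset n) → Set
UniformFamily n d 𝓕 = ∀ {F} → F ∈ 𝓕 → ∣ F ∣ ≡ d + 1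

IsWitnessChoice : {n : ℕ} → (s : ℕ) → List (Subset n) → (Subset n → Subset n) → Set
IsWitnessChoice s 𝓕 β =
  ∀ {F} → F ∈ 𝓕 →
    (β F ⊆ F) × (∣ β F ∣ ≡ s) × (∀ {F'} → F' ∈ 𝓕 → F ∩ F' ≢ β F)

IsWitnessFamily : {n : ℕ} → (s : ℕ) → List (Subset n) → Set
IsWitnessFamily {n} s 𝓕 = ∃[ β ] IsWitnessChoice s 𝓕 β

InWitnessSet : {n : ℕ} → List (Subset n) → (Subset n → Subset n) → Subset n → Set
InWitnessSet 𝓕 β B = ∃[ F ] (F ∈ 𝓕 × β F ≡ B)

-- Fix B, let L be the link {F ─ B : B ⊆ F ∈ 𝓕} and 𝓣 the family of sets lying
-- in some F ─ B with β F = B that meet every member of L. The witness condition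
-- says exactly that such an F ─ B meets every member of L, and hence also every
-- member of 𝓣. Branching on the elements of a missed set produces at most
-- (d + 1) ^ (d + 1) transversals of L ++ 𝓣 such that every transversal of size
-- at most d + 1 contains one of them. 𝓐_B consists of those lying in some F ─ B
-- with β F = B: they meet L, which gives (3); they belong to 𝓣, so they meet
-- each other; and each such F ─ B contains one of them, which gives (2).
module Submission where

open import Defs
open import Data.Nat using (ℕ; zero; suc; _≤_; _<_; _+_; _*_; _∸_; _^_; z≤n)
open import Data.Nat.Properties
  using (≤-trans; ≤-reflexive; ≤-pred; +-comm; +-suc; +-mono-≤; *-monoˡ-≤; m+n∸n≡m; m^n>0)
open import Data.Fin using (Fin)
import Data.Fin as Fin
open import Data.Fin.Subset
  using (Subset; _⊆_; _∩_; _∪_; _─_; ∣_∣; Nonempty; Empty; ⊥; ⁅_⁆; inside; outside)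
import Data.Fin.Subset as Subset
open import Data.Fin.Subset.Properties
open import Data.List using (List; []; _∷_; length; map; _++_; filter; concatMap)
open import Data.List.Properties using (length-map; length-++; length-filter)
open import Data.List.Membership.Propositional using (_∈_; find; lose)
open import Data.List.Membership.Propositional.Properties
  using (∈-map⁺; ∈-map⁻; ∈-++⁺ˡ; ∈-++⁺ʳ; ∈-filter⁺; ∈-filter⁻; ∈-concatMap⁺; ∈-concatMap⁻)
open import Data.List.Relation.Unary.All as All using (All; all?)
open import Data.List.Relation.Unary.All.Properties using (¬All⇒Any¬; ++⁺; ++⁻ˡ)
open import Data.List.Relation.Unary.Any as Any using (Any; here; there)
open import Data.Product using (_×_; _,_; proj₁; proj₂; ∃; ∃-syntax)
open import Data.Sum using (_⊎_; inj₁; inj₂)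
open import Relation.Nullary using (Dec; yes; no; contradiction)
open import Relation.Nullary.Decidable using (_×-dec_; decidable-stable)
open import Relation.Binary.PropositionalEquality
  using (_≡_; refl; sym; trans; cong; subst; module ≡-Reasoning)
open import Data.Vec using ([]; _∷_; here; there)
open import Data.Vec.Properties using (≡-dec)
open import Data.Bool using (_≟_)

private
  variable
    n : ℕ
    x : Fin n
    p q r : Subset n

elements : Subset n → List (Fin n)
elements []            = []
elements (inside  ∷ p) = Fin.zero ∷ map Fin.suc (elements p)
elements (outside ∷ p) = map Fin.suc (elements p)

∈⇒∈-elements : x Subset.∈ p → x ∈ elements p
∈⇒∈-elements {p = inside  ∷ p} here        = here refl
∈⇒∈-elements {p = inside  ∷ p} (there x∈p) = there (∈-map⁺ Fin.suc (∈⇒∈-elements x∈p))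
∈⇒∈-elements {p = outside ∷ p} (there x∈p) = ∈-map⁺ Fin.suc (∈⇒∈-elements x∈p)

length-elements : ∀ (p : Subset n) → length (elements p) ≡ ∣ p ∣
length-elements []            = refl
length-elements (inside  ∷ p) = cong suc (trans (length-map Fin.suc (elements p)) (length-elements p))
length-elements (outside ∷ p) = trans (length-map Fin.suc (elements p)) (length-elements p)

subsets : ∀ n → List (Subset n)
subsets zero    = [] ∷ []
subsets (suc n) = map (outside ∷_) (subsets n) ++ map (inside ∷_) (subsets n)

∈-subsets : ∀ (p : Subset n) → p ∈ subsets n
∈-subsets []            = here refl
∈-subsets (outside ∷ p) = ∈-++⁺ˡ (∈-map⁺ (outside ∷_) (∈-subsets p))
∈-subsets (inside  ∷ p) = ∈-++⁺ʳ (map (outside ∷_) (subsets _)) (∈-map⁺ (inside ∷_) (∈-subsets p))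

length-concatMap-≤ : ∀ {A B : Set} (f : A → List B) {m} (xs : List A) →
  (∀ x → length (f x) ≤ m) → length (concatMap f xs) ≤ length xs * m
length-concatMap-≤ f []       _     = z≤n
length-concatMap-≤ f (x ∷ xs) bound =
  ≤-trans (≤-reflexive (length-++ (f x))) (+-mono-≤ (bound x) (length-concatMap-≤ f xs bound))

x∈p─q⇒x∉q : ∀ (p q : Subset n) → x Subset.∈ p ─ q → x Subset.∉ q
x∈p─q⇒x∉q (inside ∷ p) (outside ∷ q) here          ()
x∈p─q⇒x∉q (_      ∷ p) (_       ∷ q) (there x∈p─q) (there x∈q) = x∈p─q⇒x∉q p q x∈p─q x∈q

∣p─q∣+∣q∣≡∣p∣ : ∀ (p q : Subset n) → q ⊆ p → ∣ p ─ q ∣ + ∣ q ∣ ≡ ∣ p ∣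
∣p─q∣+∣q∣≡∣p∣ []            []            _   = refl
∣p─q∣+∣q∣≡∣p∣ (inside  ∷ p) (inside  ∷ q) q⊆p =
  trans (+-suc _ _) (cong suc (∣p─q∣+∣q∣≡∣p∣ p q (drop-∷-⊆ q⊆p)))
∣p─q∣+∣q∣≡∣p∣ (inside  ∷ p) (outside ∷ q) q⊆p = cong suc (∣p─q∣+∣q∣≡∣p∣ p q (drop-∷-⊆ q⊆p))
∣p─q∣+∣q∣≡∣p∣ (outside ∷ p) (outside ∷ q) q⊆p = ∣p─q∣+∣q∣≡∣p∣ p q (drop-∷-⊆ q⊆p)
∣p─q∣+∣q∣≡∣p∣ (outside ∷ p) (inside  ∷ q) q⊆p = contradiction (q⊆p here) λ ()

p⊆q∧x∈q⇒p∪⁅x⁆⊆q : p ⊆ q → x Subset.∈ q → p ∪ ⁅ x ⁆ ⊆ q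
p⊆q∧x∈q⇒p∪⁅x⁆⊆q {p = p} {x = x} p⊆q x∈q y∈p∪⁅x⁆ with x∈p∪q⁻ p ⁅ x ⁆ y∈p∪⁅x⁆
... | inj₁ y∈p  = p⊆q y∈p
... | inj₂ y∈⁅x⁆ = subst (Subset._∈ _) (sym (x∈⁅y⁆⇒x≡y x y∈⁅x⁆)) x∈q

∣p─q∪⁅x⁆∣<∣p─q∣ : ∀ (p q : Subset n) → x Subset.∈ p ─ q → ∣ p ─ (q ∪ ⁅ x ⁆) ∣ < ∣ p ─ q ∣
∣p─q∪⁅x⁆∣<∣p─q∣ {x = x} p q x∈p─q =
  subst (λ r → ∣ r ∣ < ∣ p ─ q ∣) (p─q─r≡p─q∪r p q ⁅ x ⁆) (x∈p⇒∣p-x∣<∣p∣ x∈p─q)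

[p─r]∩[q─r]≡∅⇒p∩q≡r : ∀ (p q r : Subset n) → r ⊆ p → r ⊆ q →
  Empty ((p ─ r) ∩ (q ─ r)) → p ∩ q ≡ r
[p─r]∩[q─r]≡∅⇒p∩q≡r p q r r⊆p r⊆q disjoint =
  ⊆-antisym p∩q⊆r (λ x∈r → x∈p∩q⁺ (r⊆p x∈r , r⊆q x∈r))
  where
  p∩q⊆r : p ∩ q ⊆ r
  p∩q⊆r {x} x∈p∩q = decidable-stable (x ∈? r) λ x∉r →
    let x∈p , x∈q = x∈p∩q⁻ p q x∈p∩q in
    disjoint (x , x∈p∩q⁺ (x∈p∧x∉q⇒x∈p─q x∈p x∉r , x∈p∧x∉q⇒x∈p─q x∈q x∉r))

Meets : Subset n → Subset n → Set
Meets p q = Nonempty (p ∩ q)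

meets? : ∀ (p q : Subset n) → Dec (Meets p q)
meets? p q = nonempty? (p ∩ q)

meets-sym : Meets p q → Meets q p
meets-sym {p = p} {q} = subst Nonempty (∩-comm p q)

meets-mono : q ⊆ r → Meets p q → Meets p r
meets-mono {q = q} {p = p} q⊆r (x , x∈p∩q) =
  let x∈p , x∈q = x∈p∩q⁻ p q x∈p∩q in x , x∈p∩q⁺ (x∈p , q⊆r x∈q)

meets-outside : Meets r q → Empty (p ∩ q) → ∃ λ x → x Subset.∈ q × x Subset.∈ r ─ p
meets-outside {r = r} {q = q} (x , x∈r∩q) p∩q≡∅ =
  let x∈r , x∈q = x∈p∩q⁻ r q x∈r∩q
  in x , x∈q , x∈p∧x∉q⇒x∈p─q x∈r (λ x∈p → p∩q≡∅ (x , x∈p∩q⁺ (x∈p , x∈q)))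

Transversal : List (Subset n) → Subset n → Set
Transversal 𝓢 p = All (Meets p) 𝓢

transversal? : ∀ (𝓢 : List (Subset n)) p → Dec (Transversal 𝓢 p)
transversal? 𝓢 p = all? (meets? p) 𝓢

module TransversalSearch (𝓢 : List (Subset n)) where

  hit-or-miss : ∀ p → Transversal 𝓢 p ⊎ ∃ λ s → s ∈ 𝓢 × Empty (p ∩ s)
  hit-or-miss p with transversal? 𝓢 p
  ... | yes hit  = inj₁ hit
  ... | no ¬hit = inj₂ (find (¬All⇒Any¬ (meets? p) 𝓢 ¬hit))

  search : ℕ → Subset n → List (Subset n)
  search k p with hit-or-miss p
  ... | inj₁ _ = p ∷ []
  search zero    p | inj₂ _       = []
  search (suc k) p | inj₂ (s , _) = concatMap (λ x → search k (p ∪ ⁅ x ⁆)) (elements s)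

  search-transversal : ∀ k p {q} → q ∈ search k p → Transversal 𝓢 q
  search-transversal k p q∈ with hit-or-miss p
  search-transversal k       p (here refl) | inj₁ hit = hit
  search-transversal (suc k) p q∈         | inj₂ (s , _) =
    let x , _ , q∈′ = find (∈-concatMap⁻ (λ x → search k (p ∪ ⁅ x ⁆)) {xs = elements s} q∈)
    in search-transversal k (p ∪ ⁅ x ⁆) q∈′

  search-complete : ∀ k p {t} → p ⊆ t → ∣ t ─ p ∣ ≤ k → Transversal 𝓢 t →
                    ∃ λ q → q ∈ search k p × q ⊆ t
  search-complete k p p⊆t size hit with hit-or-miss p
  ... | inj₁ _ = p , here refl , p⊆t
  ... | inj₂ (s , s∈𝓢 , miss) with meets-outside (All.lookup hit s∈𝓢) miss
  search-complete zero    p {t} p⊆t size hit | inj₂ _ | x , _ , x∈t─p =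
    contradiction (≤-trans (∣p─q∪⁅x⁆∣<∣p─q∣ t p x∈t─p) size) λ ()
  search-complete (suc k) p {t} p⊆t size hit | inj₂ _ | x , x∈s , x∈t─p =
    let q , q∈ , q⊆t = search-complete k (p ∪ ⁅ x ⁆)
                         (p⊆q∧x∈q⇒p∪⁅x⁆⊆q p⊆t (p─q⊆p t p x∈t─p))
                         (≤-pred (≤-trans (∣p─q∪⁅x⁆∣<∣p─q∣ t p x∈t─p) size)) hit
    in q , ∈-concatMap⁺ (λ x → search k (p ∪ ⁅ x ⁆)) (lose (∈⇒∈-elements x∈s) q∈) , q⊆t

  length-search : ∀ {b} → All (λ s → ∣ s ∣ ≤ suc b) 𝓢 →
                  ∀ k p → length (search k p) ≤ suc b ^ k
  length-search {b} bounded k p with hit-or-miss p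
  ... | inj₁ _ = m^n>0 (suc b) k
  length-search bounded zero    p | inj₂ _ = z≤n
  length-search {b} bounded (suc k) p | inj₂ (s , s∈𝓢 , _) =
    ≤-trans (length-concatMap-≤ (λ x → search k (p ∪ ⁅ x ⁆)) (elements s)
                                (λ x → length-search bounded k (p ∪ ⁅ x ⁆)))
            (*-monoˡ-≤ (suc b ^ k) ∣s∣≤1+b)
    where
    ∣s∣≤1+b : length (elements s) ≤ suc b
    ∣s∣≤1+b = ≤-trans (≤-reflexive (length-elements s)) (All.lookup bounded s∈𝓢)

module WitnessLink {d s n : ℕ} {𝓕 : List (Subset n)} (uniform : UniformFamily n d 𝓕)
                   {β : Subset n → Subset n} (witness : IsWitnessChoice s 𝓕 β)
                   (B : Subset n) where

  private
    variable
      F A : Subset n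

  witnessed⇒B⊆F : F ∈ 𝓕 → β F ≡ B → B ⊆ F
  witnessed⇒B⊆F F∈𝓕 refl = proj₁ (witness F∈𝓕)

  ∣F─B∣≤1+d : F ∈ 𝓕 → ∣ F ─ B ∣ ≤ suc d
  ∣F─B∣≤1+d {F} F∈𝓕 = ≤-trans (∣p─q∣≤∣p∣ F B) (≤-reflexive (trans (uniform F∈𝓕) (+-comm d 1)))

  ∣F─B∣≡d+1∸s : F ∈ 𝓕 → β F ≡ B → ∣ F ─ B ∣ ≡ d + 1 ∸ s
  ∣F─B∣≡d+1∸s {F} F∈𝓕 βF≡B = begin
    ∣ F ─ B ∣              ≡⟨ m+n∸n≡m ∣ F ─ B ∣ s ⟨
    ∣ F ─ B ∣ + s ∸ s      ≡⟨ cong (λ k → ∣ F ─ B ∣ + k ∸ s) ∣B∣≡s ⟨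
    ∣ F ─ B ∣ + ∣ B ∣ ∸ s  ≡⟨ cong (_∸ s) (∣p─q∣+∣q∣≡∣p∣ F B (witnessed⇒B⊆F F∈𝓕 βF≡B)) ⟩
    ∣ F ∣ ∸ s              ≡⟨ cong (_∸ s) (uniform F∈𝓕) ⟩
    d + 1 ∸ s              ∎
    where
    open ≡-Reasoning
    ∣B∣≡s : ∣ B ∣ ≡ s
    ∣B∣≡s = subst (λ b → ∣ b ∣ ≡ s) βF≡B (proj₁ (proj₂ (witness F∈𝓕)))

  link : List (Subset n)
  link = map (_─ B) (filter (B ⊆?_) 𝓕)

  ∈-link⁺ : F ∈ 𝓕 → B ⊆ F → F ─ B ∈ link
  ∈-link⁺ F∈𝓕 B⊆F = ∈-map⁺ (_─ B) (∈-filter⁺ (B ⊆?_) F∈𝓕 B⊆F)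

  all-link : {P : Subset n → Set} → (∀ {F} → F ∈ 𝓕 → B ⊆ F → P (F ─ B)) → All P link
  all-link {P} P-link = All.tabulate λ A∈link →
    let F , F∈ , A≡F─B = ∈-map⁻ (_─ B) A∈link
        F∈𝓕 , B⊆F = ∈-filter⁻ (B ⊆?_) {xs = 𝓕} F∈
    in subst P (sym A≡F─B) (P-link F∈𝓕 B⊆F)

  link-transversal : F ∈ 𝓕 → β F ≡ B → Transversal link (F ─ B)
  link-transversal {F} F∈𝓕 βF≡B = all-link λ {F′} F′∈𝓕 B⊆F′ →
    decidable-stable (meets? (F ─ B) (F′ ─ B)) λ disjoint →
      proj₂ (proj₂ (witness F∈𝓕)) F′∈𝓕
        (trans ([p─r]∩[q─r]≡∅⇒p∩q≡r F F′ B (witnessed⇒B⊆F F∈𝓕 βF≡B) B⊆F′ disjoint) (sym βF≡B))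

  Admissible : Subset n → Set
  Admissible A = Any (λ F → β F ≡ B × A ⊆ F ─ B) 𝓕

  admissible? : ∀ A → Dec (Admissible A)
  admissible? A = Any.any? (λ F → ≡-dec _≟_ (β F) B ×-dec (A ⊆? F ─ B)) 𝓕

  admissible-∣A∣≤1+d : Admissible A → ∣ A ∣ ≤ suc d
  admissible-∣A∣≤1+d adm =
    let F , F∈𝓕 , _ , A⊆F─B = find adm in ≤-trans (p⊆q⇒∣p∣≤∣q∣ A⊆F─B) (∣F─B∣≤1+d F∈𝓕)

  candidates : List (Subset n)
  candidates = filter (λ A → admissible? A ×-dec transversal? link A) (subsets n)

  𝓢 : List (Subset n)
  𝓢 = link ++ candidates

  𝓢-bounded : All (λ A → ∣ A ∣ ≤ suc d) 𝓢
  𝓢-bounded = ++⁺ (all-link λ F∈𝓕 _ → ∣F─B∣≤1+d F∈𝓕) (All.tabulate λ A∈cand →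
    admissible-∣A∣≤1+d (proj₁ (proj₂ (∈-filter⁻ _ {xs = subsets n} A∈cand))))

  𝓢-transversal : F ∈ 𝓕 → β F ≡ B → Transversal 𝓢 (F ─ B)
  𝓢-transversal F∈𝓕 βF≡B = ++⁺ (link-transversal F∈𝓕 βF≡B) (All.tabulate λ A∈cand →
    let _ , _ , A-hits-link = ∈-filter⁻ _ {xs = subsets n} A∈cand
    in meets-sym (All.lookup A-hits-link (∈-link⁺ F∈𝓕 (witnessed⇒B⊆F F∈𝓕 βF≡B))))

  open TransversalSearch 𝓢

  𝓐 : List (Subset n)
  𝓐 = filter admissible? (search (d + 1) ⊥)

  ∈-𝓐⁻ : A ∈ 𝓐 → A ∈ search (d + 1) ⊥ × Admissible A
  ∈-𝓐⁻ = ∈-filter⁻ admissible? {xs = search (d + 1) ⊥}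

  𝓐-transversal : A ∈ 𝓐 → Transversal 𝓢 A
  𝓐-transversal A∈𝓐 = search-transversal (d + 1) ⊥ (proj₁ (∈-𝓐⁻ A∈𝓐))

  𝓐-outside-B : A ∈ 𝓐 → Empty (A ∩ B) × ∣ A ∣ ≤ d + 1 ∸ s
  𝓐-outside-B {A} A∈𝓐 =
    let F , F∈𝓕 , βF≡B , A⊆F─B = find (proj₂ (∈-𝓐⁻ A∈𝓐))
    in (λ (x , x∈A∩B) → let x∈A , x∈B = x∈p∩q⁻ A B x∈A∩B
                        in x∈p─q⇒x∉q F B (A⊆F─B x∈A) x∈B)
     , ≤-trans (p⊆q⇒∣p∣≤∣q∣ A⊆F─B) (≤-reflexive (∣F─B∣≡d+1∸s F∈𝓕 βF≡B))

  𝓐-intersecting : ∀ {A A′} → A ∈ 𝓐 → A′ ∈ 𝓐 → Meets A A′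
  𝓐-intersecting {A′ = A′} A∈𝓐 A′∈𝓐 =
    All.lookup (𝓐-transversal A∈𝓐) (∈-++⁺ʳ link A′∈candidates)
    where
    A′∈candidates : A′ ∈ candidates
    A′∈candidates = ∈-filter⁺ _ (∈-subsets _)
      (proj₂ (∈-𝓐⁻ A′∈𝓐) , ++⁻ˡ link (𝓐-transversal A′∈𝓐))

  𝓐-covers : F ∈ 𝓕 → β F ≡ B → ∃[ A ] (A ∈ 𝓐 × A ⊆ F)
  𝓐-covers {F} F∈𝓕 βF≡B =
    let A , A∈search , A⊆F─B = search-complete (d + 1) ⊥ ⊥⊆ size (𝓢-transversal F∈𝓕 βF≡B)
    in A , ∈-filter⁺ admissible? A∈search (lose F∈𝓕 (βF≡B , A⊆F─B))
         , ⊆-trans A⊆F─B (p─q⊆p F B)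
    where
    size : ∣ F ─ B ─ ⊥ ∣ ≤ d + 1
    size = subst (λ A → ∣ A ∣ ≤ d + 1) (sym (p─⊥≡p (F ─ B)))
                 (≤-trans (∣p─q∣≤∣p∣ F B) (≤-reflexive (uniform F∈𝓕)))

  𝓐-meets-supersets : F ∈ 𝓕 → B ⊆ F → ∀ {A} → A ∈ 𝓐 → Meets A F
  𝓐-meets-supersets {F} F∈𝓕 B⊆F A∈𝓐 =
    meets-mono (p─q⊆p F B) (All.lookup (𝓐-transversal A∈𝓐) (∈-++⁺ˡ (∈-link⁺ F∈𝓕 B⊆F)))

  length-𝓐 : length 𝓐 ≤ suc d ^ (d + 1)
  length-𝓐 = ≤-trans (length-filter admissible? (search (d + 1) ⊥))
                     (length-search 𝓢-bounded (d + 1) ⊥)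

lemma2p2 : (d : ℕ) → ∃[ C ] (∀ (s n : ℕ) → 1 ≤ s → 2 * s ≤ d → d + 1 ≤ n →
    (𝓕 : List (Subset n)) → UniformFamily n d 𝓕 →
    (β : Subset n → Subset n) → IsWitnessChoice s 𝓕 β →
    (B : Subset n) → InWitnessSet 𝓕 β B →
    ∃[ 𝓐 ] ((∀ {A} → A ∈ 𝓐 → Empty (A ∩ B) × ∣ A ∣ ≤ d + 1 ∸ s)
      × (∀ {A A'} → A ∈ 𝓐 → A' ∈ 𝓐 → Nonempty (A ∩ A'))
      × (∀ {F} → F ∈ 𝓕 → β F ≡ B → ∃[ A ] (A ∈ 𝓐 × A ⊆ F))
      × (∀ {F} → F ∈ 𝓕 → B ⊆ F → ∀ {A} → A ∈ 𝓐 → Nonempty (A ∩ F))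
      × length 𝓐 ≤ C))
lemma2p2 d = suc d ^ (d + 1) , λ s n _ _ _ 𝓕 uniform β witness B _ →
  let open WitnessLink uniform witness B
  in 𝓐 , 𝓐-outside-B , 𝓐-intersecting , 𝓐-covers , 𝓐-meets-supersets , length-𝓐
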